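{- Let $P=(P,\leq_P,\textrm{Con}_P,\equiv_P)$ and $Q=(Q,\leq_Q,\textrm{Con}_Q,\equiv_Q)$ be event structures with equivalence, and let $f:P\rightharpoonup Q$ be a partial function which preserves $\equiv$ (i.e. if $p_1\equiv_P p_2$ then either both $f(p_1),f(p_2)$ are undefined, or both are defined and $f(p_1)\equiv_Q f(p_2)$). Then $f$ is a map of event structures with equivalence from $P$ to $Q$ if and only if (i) for all $X\in\textrm{Con}_P$ the direct image $fX\in\textrm{Con}_Q$, and for all $p_1,p_2\in X$ with $f(p_1),f(p_2)$ defined, $f(p_1)\equiv_Q f(p_2)$ implies $p_1\equiv_P p_2$; and (ii) whenever $q\leq_Q f(p)$ there is $p'\leq_P p$ such that $f(p')=q$.
   Context: A prime event structure $(E,\leq,\textrm{Con})$ consists of a set $E$ of events, a partial order $\leq$ on $E$, and a non-empty set $\textrm{Con}$ of finite subsets of $E$ such that: $[e]=\{e'\mid e'\leq e\}$ is finite for all $e$; $\{e\}\in\textrm{Con}$ for all $e$; $X\subseteq Y\in\textrm{Con}\Rightarrow X\in\textrm{Con}$; and $X\in\textrm{Con}$, $e\leq e'\in X$ imply $X\cup\{e\}\in\textrm{Con}$. A configuration is a (possibly infinite) subset $x\subseteq E$ that is down-closed and all of whose finite subsets are in $\textrm{Con}$; $\mathcal{C}^\infty(E)$ denotes the set of configurations. An event structure with equivalence (ese) is $(P,\leq,\textrm{Con},\equiv)$ with $(P,\leq,\textrm{Con})$ a prime event structure and $\equiv$ an equivalence relation on $P$. A map of eses from $P$ to $Q$ is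 a partial function $f:P\rightharpoonup Q$ which preserves $\equiv$ (as in the claim) such that for every configuration $x$ of $P$, the image $fx$ is a configuration of $Q$, and for all $p_1,p_2\in x$ with $f(p_1),f(p_2)$ defined, $f(p_1)\equiv_Q f(p_2)$ implies $p_1\equiv_P p_2$. -}

module Defs where

open import Level using (0ℓ)
open import Data.List using (List; _∷_; []; mapMaybe)
open import Data.List.Membership.Propositional using (_∈_)
open import Data.List.Relation.Binary.Subset.Propositional using (_⊆_)
open import Data.Maybe using (Maybe; just; nothing)
open import Data.Product using (Σ; ∃; ∃-syntax; _×_; _,_)
open import Data.Sum using (_⊎_)
open import Relation.Binary.PropositionalEquality using (_≡_)
open import Relation.Binary.Structures using (IsPartialOrder; IsEquivalence)
open import Relation.Unary using (Pred)

-- Finite subsets of E are represented by lists (membership-based; Con is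
-- invariant under having the same elements because of the ⊆-closure axiom).

record PrimeES : Set₁ where
  field
    E        : Set
    _≤_      : E → E → Set
    Con      : List E → Set
    isPO     : IsPartialOrder _≡_ _≤_
    finite-↓ : ∀ e → ∃[ L ] (∀ e' → (e' ≤ e → e' ∈ L) × (e' ∈ L → e' ≤ e))
    con-ne   : ∃[ X ] Con X
    con-sing : ∀ e → Con (e ∷ [])
    con-⊆    : ∀ {X Y} → X ⊆ Y → Con Y → Con X
    con-↓    : ∀ {X e e'} → Con X → e ≤ e' → e' ∈ X → Con (e ∷ X)

  record IsConfig (x : Pred E 0ℓ) : Set where
    field
      down-closed : ∀ {e e'} → e ≤ e' → x e' → x e
      consistent  : ∀ (L : List E) → (∀ {e} → e ∈ L → x e) → Con L

record ESE : Set₁ where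
  field
    pes   : PrimeES
  open PrimeES pes public
  field
    _≈_   : E → E → Set
    isEq  : IsEquivalence _≈_

open ESE

Preserves≈ : (P Q : ESE) → (E P → Maybe (E Q)) → Set
Preserves≈ P Q f = ∀ {p₁ p₂} → _≈_ P p₁ p₂ →
  (f p₁ ≡ nothing × f p₂ ≡ nothing)
  ⊎ (∃[ q₁ ] ∃[ q₂ ] (f p₁ ≡ just q₁ × f p₂ ≡ just q₂ × _≈_ Q q₁ q₂))

image : {A B : Set} → (A → Maybe B) → Pred A 0ℓ → Pred B 0ℓ
image f x q = ∃[ p ] (x p × f p ≡ just q)

Reflects≈ : (P Q : ESE) → (E P → Maybe (E Q)) → E P → E P → Set
Reflects≈ P Q f p₁ p₂ = ∀ {q₁ q₂} → f p₁ ≡ just q₁ → f p₂ ≡ just q₂ →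
  _≈_ Q q₁ q₂ → _≈_ P p₁ p₂

record IsESEMap (P Q : ESE) (f : E P → Maybe (E Q)) : Set₁ where
  field
    pres≈     : Preserves≈ P Q f
    conf      : ∀ (x : Pred (E P) 0ℓ) → IsConfig P x → IsConfig Q (image f x)
    reflect≈  : ∀ (x : Pred (E P) 0ℓ) → IsConfig P x →
                ∀ {p₁ p₂} → x p₁ → x p₂ → Reflects≈ P Q f p₁ p₂

Cond-i : (P Q : ESE) → (E P → Maybe (E Q)) → Set
Cond-i P Q f = ∀ (X : List (E P)) → Con P X →
  Con Q (mapMaybe f X)
  × (∀ {p₁ p₂} → p₁ ∈ X → p₂ ∈ X → Reflects≈ P Q f p₁ p₂)

Cond-ii : (P Q : ESE) → (E P → Maybe (E Q)) → Set
Cond-ii P Q f = ∀ {p q q'} → f p ≡ just q' → _≤_ Q q q' →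
  ∃[ p' ] (_≤_ P p' p × f p' ≡ just q)

{-# OPTIONS --safe #-}
module Submission where

open import Defs
open import Level using (0ℓ)
open import Data.Maybe using (Maybe; just; nothing)
open import Data.Product using (_×_; _,_; ∃-syntax; proj₁; proj₂)
open import Data.List using (List; _∷_; []; mapMaybe; _++_)
open import Data.List.Membership.Propositional using (_∈_)
open import Data.List.Membership.Propositional.Properties using (∈-++⁺ʳ)
open import Data.List.Relation.Binary.Subset.Propositional.Properties using (xs⊆xs++ys)
open import Data.List.Relation.Unary.Any using (here; there)
open import Relation.Binary.PropositionalEquality using (_≡_; refl; subst)
open import Relation.Binary.Structures using (IsPartialOrder; IsPreorder)
open import Relation.Unary using (Pred)
open import Function.Bundles using (_⇔_; mk⇔)

-- A map of eses is tested on configurations, conditions (i) and (ii) on finite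
-- consistent sets and single events. The bridge: the down-closure of a finite
-- consistent set is a configuration, and every finite subset of the image of a
-- configuration is the image of a finite subset of that configuration.

∈-mapMaybe⁻ : {A B : Set} (f : A → Maybe B) (X : List A) {q : B} →
  q ∈ mapMaybe f X → ∃[ p ] (p ∈ X × f p ≡ just q)
∈-mapMaybe⁻ f (p ∷ X) q∈ with f p in fp≡
... | nothing = let (p' , p'∈ , fp') = ∈-mapMaybe⁻ f X q∈ in p' , there p'∈ , fp'
... | just _ with q∈
...   | here refl = p , here refl , fp≡
...   | there q∈′ = let (p' , p'∈ , fp') = ∈-mapMaybe⁻ f X q∈′ in p' , there p'∈ , fp'

mapMaybe-preimage : {A B : Set} (f : A → Maybe B) (x : Pred A 0ℓ) (L : List B) →
  (∀ {q} → q ∈ L → image f x q) →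
  ∃[ K ] ((∀ {p} → p ∈ K → x p) × mapMaybe f K ≡ L)
mapMaybe-preimage f x [] _ = [] , (λ ()) , refl
mapMaybe-preimage f x (q ∷ L) L⊆fx
  with L⊆fx (here refl) | mapMaybe-preimage f x L (λ q∈ → L⊆fx (there q∈))
... | p , xp , fp≡q | K , K⊆x , fK≡L = p ∷ K , p∷K⊆x , fp∷K≡q∷L
  where
  p∷K⊆x : ∀ {p'} → p' ∈ p ∷ K → x p'
  p∷K⊆x (here refl) = xp
  p∷K⊆x (there p'∈) = K⊆x p'∈
  fp∷K≡q∷L : mapMaybe f (p ∷ K) ≡ q ∷ L
  fp∷K≡q∷L rewrite fp≡q | fK≡L = refl

module _ (P : PrimeES) where
  open PrimeES P
  open IsPreorder (IsPartialOrder.isPreorder isPO) using () renaming (refl to ≤-refl; trans to ≤-trans)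

  ↓ : List E → Pred E 0ℓ
  ↓ X e = ∃[ e' ] (e ≤ e' × e' ∈ X)

  ∈⇒∈↓ : ∀ {X e} → e ∈ X → ↓ X e
  ∈⇒∈↓ {e = e} e∈X = e , ≤-refl , e∈X

  Con-++-↓ : ∀ {X} → Con X → (L : List E) → (∀ {e} → e ∈ L → ↓ X e) → Con (L ++ X)
  Con-++-↓ conX [] _ = conX
  Con-++-↓ conX (e ∷ L) L⊆↓X with L⊆↓X (here refl)
  ... | e' , e≤e' , e'∈X =
    con-↓ (Con-++-↓ conX L (λ e∈L → L⊆↓X (there e∈L))) e≤e' (∈-++⁺ʳ L e'∈X)

  ↓-isConfig : ∀ {X} → Con X → IsConfig (↓ X)
  ↓-isConfig {X} conX = record
    { down-closed = λ { e≤e' (e'' , e'≤e'' , e''∈X) → e'' , ≤-trans e≤e' e'≤e'' , e''∈X }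
    ; consistent  = λ L L⊆↓X → con-⊆ (xs⊆xs++ys L X) (Con-++-↓ conX L L⊆↓X)
    }

open ESE

module _ (P Q : ESE) (f : E P → Maybe (E Q)) where

  isESEMap⇒cond-i : IsESEMap P Q f → Cond-i P Q f
  isESEMap⇒cond-i m X conX = image-consistent ,
    λ p₁∈ p₂∈ → reflect≈ _ ↓X-config (∈⇒∈↓ (pes P) p₁∈) (∈⇒∈↓ (pes P) p₂∈)
    where
    open IsESEMap m
    ↓X-config : IsConfig P (↓ (pes P) X)
    ↓X-config = ↓-isConfig (pes P) conX
    image-consistent : Con Q (mapMaybe f X)
    image-consistent = IsConfig.consistent {Q} (conf _ ↓X-config) (mapMaybe f X)
      λ q∈ → let (p , p∈X , fp≡q) = ∈-mapMaybe⁻ f X q∈ in p , ∈⇒∈↓ (pes P) p∈X , fp≡q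

  isESEMap⇒cond-ii : IsESEMap P Q f → Cond-ii P Q f
  isESEMap⇒cond-ii m {p} fp≡q' q≤q'
    with IsConfig.down-closed {Q} (IsESEMap.conf m _ (↓-isConfig (pes P) (con-sing P p))) q≤q'
           (p , ∈⇒∈↓ (pes P) (here refl) , fp≡q')
  ... | p' , (_ , p'≤p , here refl) , fp'≡q = p' , p'≤p , fp'≡q

  isESEMap⇒conds : IsESEMap P Q f → Cond-i P Q f × Cond-ii P Q f
  isESEMap⇒conds m = isESEMap⇒cond-i m , λ {p} {q} {q'} → isESEMap⇒cond-ii m

  cond-ii⇒image-down-closed : Cond-ii P Q f → ∀ {x} → IsConfig P x →
    ∀ {q q'} → _≤_ Q q q' → image f x q' → image f x q
  cond-ii⇒image-down-closed cii x-config q≤q' (p , xp , fp≡q')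
    with cii fp≡q' q≤q'
  ... | p' , p'≤p , fp'≡q = p' , IsConfig.down-closed {P} x-config p'≤p xp , fp'≡q

  cond-i⇒image-consistent : Cond-i P Q f → ∀ {x} → IsConfig P x →
    ∀ L → (∀ {q} → q ∈ L → image f x q) → Con Q L
  cond-i⇒image-consistent ci {x} x-config L L⊆fx with mapMaybe-preimage f x L L⊆fx
  ... | K , K⊆x , fK≡L = subst (Con Q) fK≡L (proj₁ (ci K (IsConfig.consistent {P} x-config K K⊆x)))

  cond-i⇒reflect≈ : Cond-i P Q f → ∀ {x} → IsConfig P x →
    ∀ {p₁ p₂} → x p₁ → x p₂ → Reflects≈ P Q f p₁ p₂
  cond-i⇒reflect≈ ci {x} x-config {p₁} {p₂} xp₁ xp₂ =
    proj₂ (ci (p₁ ∷ p₂ ∷ []) (IsConfig.consistent {P} x-config _ p₁p₂⊆x)) (here refl) (there (here refl))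
    where
    p₁p₂⊆x : ∀ {p} → p ∈ p₁ ∷ p₂ ∷ [] → x p
    p₁p₂⊆x (here refl)         = xp₁
    p₁p₂⊆x (there (here refl)) = xp₂

  conds⇒isESEMap : Preserves≈ P Q f → Cond-i P Q f × Cond-ii P Q f → IsESEMap P Q f
  conds⇒isESEMap pres (ci , cii) = record
    { pres≈    = pres
    ; conf     = λ _ x-config → record
        { down-closed = cond-ii⇒image-down-closed cii x-config
        ; consistent  = cond-i⇒image-consistent ci x-config
        }
    ; reflect≈ = λ _ → cond-i⇒reflect≈ ci
    }

proposition3p1 : (P Q : ESE) (f : ESE.E P → Maybe (ESE.E Q)) →
    Preserves≈ P Q f →
    IsESEMap P Q f ⇔ (Cond-i P Q f × Cond-ii P Q f)
proposition3p1 P Q f pres = mk⇔ (isESEMap⇒conds P Q f) (conds⇒isESEMap P Q f pres)
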